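{- For all names $P,Q$: if $\eta\,Q\,Q$ and $\eta\,P\,(\mathit{closure}\,Q)$, then $Q \equiv \mathit{interior}\,P$.
   Context: Setting: a Coq formalization (classical logic) of Leśniewski's Ontology and Mereology. There is a type $N$ of names and a primitive relation $\eta : N\to N\to\mathrm{Prop}$ satisfying Leśniewski's ontological axiom: $\eta\,A\,b \leftrightarrow \big((\exists C,\ \eta\,C\,A)\wedge(\forall C\,D,\ \eta\,C\,A\wedge\eta\,D\,A\to\eta\,C\,D)\wedge(\forall C,\ \eta\,C\,A\to\eta\,C\,b)\big)$. $A$ is an individual iff $\eta\,A\,A$. For names $a,b$: $\eta\,P\,(a\cap b)\leftrightarrow(\eta\,P\,a\wedge\eta\,P\,b)$; $P\equiv Q$ means $\eta\,P\,Q\wedge\eta\,Q\,P$; $V$ is the universal name ($\eta\,P\,V\leftrightarrow\eta\,P\,P$). Mereology: $pt:N\to N$ ($\eta\,B\,(pt\,A)$: $B$ is a part of $A$) satisfying Leśniewski's mereology axioms (part-of is a partial order on individuals; every non-empty name has a unique m-class). M-class: $\eta\,A\,(klass\,a)$ iff $\eta\,A\,A$, $\forall B,\ \eta\,B\,a\to\eta\,B\,(pt\,A)$, and $\forall B,\ \eta\,B\,(pt\,A)\to\exists C\,D,\ \eta\,C\,a\wedge\eta\,D\,(pt\,C)\wedge\eta\,D\,(pt\,B)$. $\eta\,P\,(ext\,Q)$ iff $P,Q$ are individuals having no common part. $\eta\,P\,\mathit{Universe}$ iff $\eta\,P\,(klass\,V)$. $\mathit{compl}\,Q$ is the mereological complement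 of $Q$ relative to $\mathit{Universe}$: $\eta\,P\,(\mathit{compl}\,Q)$ iff $\eta\,Q\,(pt\,\mathit{Universe})$ and $\eta\,P\,(klass\,((pt\,\mathit{Universe})\cap(ext\,Q)))$. Interior: $\eta\,P\,(\mathit{interior}\,Q)$ iff $\eta\,Q\,Q\wedge\eta\,P\,Q$. Closure: $\eta\,P\,(\mathit{closure}\,Q)$ iff $\eta\,Q\,Q$ and $\exists R\,S,\ \eta\,R\,(\mathit{compl}\,Q)\wedge\eta\,S\,(\mathit{interior}\,R)\wedge\eta\,P\,(\mathit{compl}\,S)$. -}

module Defs where

open import Data.Product using (_×_; ∃; ∃-syntax; _,_)
open import Data.Empty using (⊥)
open import Relation.Nullary using (¬_; Dec)
open import Function.Bundles using (_⇔_)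

-- Classical logic (the paper's Coq development assumes it).
Classical : Set₁
Classical = (X : Set) → Dec X

-- Leśniewski's Ontology: a type of names with the primitive η,
-- subject to the ontological axiom, together with the defined names
-- used in the paper (intersection, universal name), each given by its
-- defining equivalence.
record Ontology : Set₁ where
  field
    N   : Set
    η   : N → N → Set
    ontological-axiom : ∀ A b →
      η A b ⇔ ((∃[ C ] η C A)
               × (∀ C D → η C A → η D A → η C D)
               × (∀ C → η C A → η C b))
    _∩_ : N → N → N
    ∩-def : ∀ P a b → η P (a ∩ b) ⇔ (η P a × η P b)
    V   : N
    V-def : ∀ P → η P V ⇔ η P P

  infixl 7 _∩_

  _≣_ : N → N → Set
  P ≣ Q = η P Q × η Q P

record Mereology : Set₁ where
  field
    ontology : Ontology
  open Ontology ontology public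
  field
    pt : N → N
    pt-individual : ∀ A B → η A (pt B) → η B B
    pt-refl  : ∀ A → η A A → η A (pt A)
    pt-antisym : ∀ A B → η A (pt B) → η B (pt A) → A ≣ B
    pt-trans : ∀ A B C → η A (pt B) → η B (pt C) → η A (pt C)
    klass : N → N
    klass-def : ∀ A a → η A (klass a) ⇔
      (η A A
       × (∀ B → η B a → η B (pt A))
       × (∀ B → η B (pt A) → ∃[ C ] ∃[ D ] (η C a × η D (pt C) × η D (pt B))))
    klass-exists : ∀ a → (∃[ C ] η C a) → ∃[ A ] η A (klass a)
    klass-unique : ∀ a A B → η A (klass a) → η B (klass a) → η A B
    ext : N → N
    ext-def : ∀ P Q → η P (ext Q) ⇔
      (η P P × η Q Q × ¬ (∃[ C ] (η C (pt P) × η C (pt Q))))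
    Universe : N
    Universe-def : ∀ P → η P Universe ⇔ η P (klass V)
    compl : N → N
    compl-def : ∀ P Q → η P (compl Q) ⇔
      (η Q (pt Universe) × η P (klass (pt Universe ∩ ext Q)))
    interior : N → N
    interior-def : ∀ P Q → η P (interior Q) ⇔ (η Q Q × η P Q)
    closure : N → N
    closure-def : ∀ P Q → η P (closure Q) ⇔
      (η Q Q × ∃[ R ] ∃[ S ] (η R (compl Q) × η S (interior R) × η P (compl S)))

{-# OPTIONS --safe #-}
-- The closure of Q is compl (interior (compl Q)), and the interior of an
-- individual is that individual, so the closure is the double complement P
-- of Q.  Q is exterior to compl Q, hence a part of P.  Conversely every part
-- of P overlaps Q: otherwise some piece of it would be a part of the universe
-- exterior to Q, hence a part of compl Q, while also lying in something
-- exterior to compl Q (this case split is where classical logic enters).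
-- So P, like Q, is the m-class of the parts of Q, and uniqueness of classes
-- gives Q ≣ P ≣ interior P.
module Submission where

open import Defs
open import Data.Product using (_×_; ∃-syntax; _,_; proj₁; proj₂; swap)
open import Data.Empty using (⊥-elim)
open import Relation.Nullary using (¬_; yes; no)
open import Function.Bundles using (Equivalence)

open Equivalence using (to; from)

module OntologyProperties (O : Ontology) where
  open Ontology O

  η-individual : ∀ {A b} → η A b → η A A
  η-individual {A} {b} A∈b with to (ontological-axiom A b) A∈b
  ... | nonempty , singular , _ =
    from (ontological-axiom A A) (nonempty , singular , λ _ C∈A → C∈A)

  η-singular : ∀ {A b C D} → η A b → η C A → η D A → η C D
  η-singular {A} {b} A∈b = proj₁ (proj₂ (to (ontological-axiom A b) A∈b)) _ _

  η-trans : ∀ {A B c} → η A B → η B c → η A c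
  η-trans {A} {B} {c} A∈B B∈c with to (ontological-axiom A B) A∈B
  ... | nonempty , singular , A⊆B = from (ontological-axiom A c)
    (nonempty , singular , λ C C∈A → B⊆c C (A⊆B C C∈A))
    where
    B⊆c : ∀ C → η C B → η C c
    B⊆c = proj₂ (proj₂ (to (ontological-axiom B c) B∈c))

  η-sym : ∀ {A B} → η A B → η B B → η B A
  η-sym {A} {B} A∈B B∈B = from (ontological-axiom B A)
    ((B , B∈B) , (λ _ _ → η-singular B∈B) , λ _ C∈B → η-singular B∈B C∈B A∈B)

  ≣-sym : ∀ {A B} → A ≣ B → B ≣ A
  ≣-sym = swap

  ≣-trans : ∀ {A B C} → A ≣ B → B ≣ C → A ≣ C
  ≣-trans (A∈B , B∈A) (B∈C , C∈B) = η-trans A∈B B∈C , η-trans C∈B B∈A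

  ≣-individual : ∀ {a P} → η P P → η P a → (∀ C → η C a → η C P) → a ≣ P
  ≣-individual {a} {P} P∈P P∈a a⊆P = a∈P , P∈a
    where
    a∈P : η a P
    a∈P = from (ontological-axiom a P)
      ((P , P∈a) , (λ C D C∈a D∈a → η-singular P∈P (a⊆P C C∈a) (a⊆P D D∈a)) , a⊆P)

  ∩-elim : ∀ {P a b} → η P (a ∩ b) → η P a × η P b
  ∩-elim = to (∩-def _ _ _)

  ∩-congʳ : ∀ {P a b c} → (∀ X → η X b → η X c) → η P (a ∩ b) → η P (a ∩ c)
  ∩-congʳ b⊆c P∈a∩b with ∩-elim P∈a∩b
  ... | P∈a , P∈b = from (∩-def _ _ _) (P∈a , b⊆c _ P∈b)

module MereologyProperties (M : Mereology) where
  open Mereology M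
  open OntologyProperties ontology

  Overlap : N → N → Set
  Overlap A B = ∃[ C ] (η C (pt A) × η C (pt B))

  ext-disjoint : ∀ {A B} → η A (ext B) → ¬ Overlap A B
  ext-disjoint {A} {B} A∈extB = proj₂ (proj₂ (to (ext-def A B) A∈extB))

  pt-resp-≣ : ∀ {A B C} → A ≣ B → η C (pt A) → η C (pt B)
  pt-resp-≣ {A} {B} {C} (A∈B , B∈A) C≤A =
    pt-trans C A B C≤A (η-trans A∈B (pt-refl B (η-individual B∈A)))

  ext-resp-≣ : ∀ {A B X} → A ≣ B → η X (ext A) → η X (ext B)
  ext-resp-≣ {A} {B} {X} A≣B X∈extA = from (ext-def X B)
    ( proj₁ (to (ext-def X A) X∈extA)
    , η-individual (proj₂ A≣B)
    , λ (C , C≤X , C≤B) → ext-disjoint X∈extA (C , C≤X , pt-resp-≣ (≣-sym A≣B) C≤B))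

  klass-cong : ∀ {a b P} → (∀ X → η X a → η X b) → (∀ X → η X b → η X a) →
               η P (klass a) → η P (klass b)
  klass-cong {a} {b} {P} a⊆b b⊆a P∈Kla with to (klass-def P a) P∈Kla
  ... | P∈P , a≤P , dense = from (klass-def P b)
    (P∈P , (λ B B∈b → a≤P B (b⊆a B B∈b)) , dense′)
    where
    dense′ : ∀ B → η B (pt P) → ∃[ C ] ∃[ D ] (η C b × η D (pt C) × η D (pt B))
    dense′ B B≤P with dense B B≤P
    ... | C , D , C∈a , D≤C , D≤B = C , D , a⊆b C C∈a , D≤C , D≤B

  compl-resp-≣ : ∀ {A B P} → A ≣ B → η P (compl A) → η P (compl B)
  compl-resp-≣ {A} {B} {P} A≣B P∈complA with to (compl-def P A) P∈complA
  ... | A≤U , P∈Kl = from (compl-def P B)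
    ( η-trans (proj₂ A≣B) A≤U
    , klass-cong (λ _ → ∩-congʳ (λ _ → ext-resp-≣ A≣B))
                 (λ _ → ∩-congʳ (λ _ → ext-resp-≣ (≣-sym A≣B))) P∈Kl)

  klass-pt : ∀ {Q} → η Q Q → η Q (klass (pt Q))
  klass-pt {Q} Q∈Q = from (klass-def Q (pt Q))
    (Q∈Q , (λ _ B≤Q → B≤Q) , λ B B≤Q → let B≤B = pt-refl B (η-individual B≤Q)
                                        in B , B , B≤Q , B≤B , B≤B)

  supplementation : ∀ {P Q} → η Q (pt P) → (∀ X → η X (pt P) → Overlap X Q) → η Q P
  supplementation {P} {Q} Q≤P overlapsQ =
    klass-unique (pt Q) Q P (klass-pt (η-individual Q≤P)) P∈KlptQ
    where
    P∈KlptQ : η P (klass (pt Q))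
    P∈KlptQ = from (klass-def P (pt Q))
      ( pt-individual Q P Q≤P
      , (λ B B≤Q → pt-trans B Q P B≤Q Q≤P)
      , λ X X≤P → let (E , E≤X , E≤Q) = overlapsQ X X≤P
                  in E , E , E≤Q , pt-refl E (η-individual E≤Q) , E≤X)

  interior-≣ : ∀ {S R} → η S (interior R) → S ≣ R
  interior-≣ {S} {R} S∈intR with to (interior-def S R) S∈intR
  ... | R∈R , S∈R = S∈R , η-sym S∈R R∈R

  interior-of-individual : ∀ {P} → η P P → interior P ≣ P
  interior-of-individual {P} P∈P = ≣-individual P∈P
    (from (interior-def P P) (P∈P , P∈P))
    (λ C C∈intP → proj₂ (to (interior-def C P) C∈intP))

  compl-pt-Universe : ∀ {R Q} → η R (compl Q) → η Q (pt Universe)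
  compl-pt-Universe {R} {Q} R∈complQ = proj₁ (to (compl-def R Q) R∈complQ)

  compl-maximal : ∀ {R Q D} → η R (compl Q) → η D (pt Universe) → η D (ext Q) →
                  η D (pt R)
  compl-maximal {R} {Q} {D} R∈complQ D≤U D∈extQ =
    proj₁ (proj₂ (to (klass-def R _) (proj₂ (to (compl-def R Q) R∈complQ))))
      D (from (∩-def _ _ _) (D≤U , D∈extQ))

  compl-dense : ∀ {R Q X} → η R (compl Q) → η X (pt R) →
                ∃[ C ] ∃[ D ] (η C (pt Universe) × η C (ext Q) × η D (pt C) × η D (pt X))
  compl-dense {R} {Q} {X} R∈complQ X≤R
    with proj₂ (proj₂ (to (klass-def R _) (proj₂ (to (compl-def R Q) R∈complQ)))) X X≤R
  ... | C , D , C∈U∩extQ , D≤C , D≤X =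
    C , D , proj₁ (∩-elim C∈U∩extQ) , proj₂ (∩-elim C∈U∩extQ) , D≤C , D≤X

  compl-ext : ∀ {R Q} → η R (compl Q) → η Q (ext R)
  compl-ext {R} {Q} R∈complQ = from (ext-def Q R)
    (η-individual (compl-pt-Universe R∈complQ) , η-individual R∈complQ , disjoint)
    where
    disjoint : ¬ Overlap Q R
    disjoint (C , C≤Q , C≤R) with compl-dense R∈complQ C≤R
    ... | C′ , D , _ , C′∈extQ , D≤C′ , D≤C =
      ext-disjoint C′∈extQ (D , D≤C′ , pt-trans D C Q D≤C C≤Q)

  compl-involutive : Classical → ∀ {Q R P} → η R (compl Q) → η P (compl R) → Q ≣ P
  compl-involutive classical {Q} {R} {P} R∈complQ P∈complR =
    Q∈P , η-sym Q∈P (pt-individual Q P Q≤P)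
    where
    Q≤U : η Q (pt Universe)
    Q≤U = compl-pt-Universe R∈complQ

    Q≤P : η Q (pt P)
    Q≤P = compl-maximal P∈complR Q≤U (compl-ext R∈complQ)

    overlapsQ : ∀ X → η X (pt P) → Overlap X Q
    overlapsQ X X≤P with compl-dense P∈complR X≤P
    ... | C , D , C≤U , C∈extR , D≤C , D≤X with classical (Overlap D Q)
    ... | yes (E , E≤D , E≤Q) = E , pt-trans E D X E≤D D≤X , E≤Q
    ... | no D-disjoint-Q = ⊥-elim (ext-disjoint C∈extR (D , D≤C , D≤R))
      where
      D≤R : η D (pt R)
      D≤R = compl-maximal R∈complQ (pt-trans D C Universe D≤C C≤U)
        (from (ext-def D Q) (η-individual D≤C , η-individual Q≤U , D-disjoint-Q))

    Q∈P : η Q P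
    Q∈P = supplementation Q≤P overlapsQ

  closure-≣ : Classical → ∀ {P Q} → η P (closure Q) → Q ≣ P
  closure-≣ classical {P} {Q} P∈clQ with to (closure-def P Q) P∈clQ
  ... | _ , R , S , R∈complQ , S∈intR , P∈complS =
    compl-involutive classical R∈complQ (compl-resp-≣ (interior-≣ S∈intR) P∈complS)

lemma2 : Classical → (M : Mereology) → let open Mereology M in
    ∀ P Q → η Q Q → η P (closure Q) → Q ≣ interior P
-- The hypothesis η Q Q is redundant: closure-def already includes it.
lemma2 classical M P Q _ P∈clQ =
  ≣-trans Q≣P (≣-sym (interior-of-individual (η-individual (proj₂ Q≣P))))
  where
  open Mereology M
  open OntologyProperties ontology
  open MereologyProperties M

  Q≣P : Q ≣ P
  Q≣P = closure-≣ classical P∈clQ
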